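{- Let $q\geq 2$ and let $C$ be a completely regular code in $H(3,q)$ with covering radius $1$. Then $C$ fulfills the strong clique property if and only if $C$ is obtained by Construction D.
   Context: Let $\mathcal{A}$ be a set of size $q\geq 2$; $H(3,q)$ has vertex set $\mathcal{A}^3$, tuples adjacent iff they differ in exactly one position. A set $C$ of vertices is a completely regular code with covering radius $1$ if $C$ is a nonempty proper subset and there are integers $\beta,\gamma\geq1$ such that every vertex of $C$ has exactly $\beta$ neighbours outside $C$ and every vertex outside $C$ has exactly $\gamma$ neighbours in $C$. A maximum clique of codirection $i\in\{1,2,3\}$ in $H(3,q)$ is a set of $q$ tuples that agree in all positions except position $i$ and take all $q$ symbols in position $i$. $C$ fulfills the clique property if $C$ is a union of pairwise disjoint maximum cliques; it fulfills the strong clique property if moreover among these cliques there are cliques of each of the three codirections. For $X\subseteq\mathcal{A}$ write $\overline{X}=\mathcal{A}\setminus X$. Construction D: a set $C\subseteq\mathcal{A}^3$ is obtained by Construction D if there are nonempty proper subsets $R,S,T$ of $\mathcal{A}$, positive integers $a,b,c$, and sets $D^1\subseteq S\times T$, $D^2\subseteq R\times\overline{T}$, $D^3\subseteq\overline{R}\times\overline{S}$ such that: $|D^1\cap (S\times\{v\})|=a$ for all $v\in T$ and $|D^1\cap(\{u\}\times T)|=b$ for all $u\in S$; $|D^2\cap (R\times\{v\})|=a$ for all $v\in \overline T$ and $|D^2\cap(\{u\}\times \overline T)|=c$ for all $u\in R$; $|D^3\cap (\overline R\times\{v\})|=b$ for all $v\in \overline S$ and $|D^3\cap(\{u\}\times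 \overline S)|=c$ for all $u\in \overline R$; and $C=\{x: (x_2,x_3)\in D^1\}\cup\{x:(x_1,x_3)\in D^2\}\cup\{x:(x_1,x_2)\in D^3\}$. -}

module Defs where

open import Data.Nat using (ℕ; zero; suc; _+_; _≥_)
open import Data.Bool using (Bool; true; false; if_then_else_; not; _∧_; _∨_)
open import Data.Fin using (Fin; zero; suc; _≟_)
open import Data.Product using (Σ; ∃; ∃-syntax; _×_; _,_; proj₁; proj₂)
open import Relation.Nullary using (¬_; does)
open import Relation.Binary.PropositionalEquality using (_≡_; _≢_)

-- The alphabet is Fin q.  Vertices of H(3,q): tuples x : Fin 3 → Fin q
-- (position 1,2,3 of the paper = zero, suc zero, suc (suc zero)).
Word : ℕ → Set
Word q = Fin 3 → Fin q

p₁ p₂ p₃ : Fin 3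
p₁ = zero
p₂ = suc zero
p₃ = suc (suc zero)

Pred : Set → Set
Pred A = A → Bool

count : {n : ℕ} → (Fin n → Bool) → ℕ
count {zero}  f = 0
count {suc n} f = (if f zero then 1 else 0) + count (λ i → f (suc i))

setAt : {q : ℕ} → Word q → Fin 3 → Fin q → Word q
setAt x i a j = if does (j ≟ i) then a else x j

-- Two tuples are adjacent in H(3,q) iff they differ in exactly one position.
-- The neighbours of x are exactly the tuples setAt x i a with a ≢ x i, and
-- different pairs (i , a) give different neighbours.  Hence the number of
-- neighbours of x lying in a set P is:

nbrCount : {q : ℕ} → Pred (Word q) → Word q → ℕ
nbrCount {q} P x =
    count (λ (a : Fin q) → not (does (a ≟ x p₁)) ∧ P (setAt x p₁ a))
  + count (λ (a : Fin q) → not (does (a ≟ x p₂)) ∧ P (setAt x p₂ a))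
  + count (λ (a : Fin q) → not (does (a ≟ x p₃)) ∧ P (setAt x p₃ a))

complement : {A : Set} → Pred A → Pred A
complement P x = not (P x)

NonemptyProper : {A : Set} → Pred A → Set
NonemptyProper P = (∃[ x ] P x ≡ true) × (∃[ x ] P x ≡ false)

CompletelyRegular1 : {q : ℕ} → Pred (Word q) → Set
CompletelyRegular1 {q} C =
  NonemptyProper C ×
  (∃[ β ] ∃[ γ ] (β ≥ 1) × (γ ≥ 1) ×
     ((x : Word q) → C x ≡ true  → nbrCount (complement C) x ≡ β) ×
     ((x : Word q) → C x ≡ false → nbrCount C x ≡ γ))

-- The maximum clique of codirection i through x: all y agreeing with x
-- outside position i (these are q tuples taking all symbols at position i).
InClique : {q : ℕ} → Fin 3 → Word q → Word q → Set
InClique i x y = (j : Fin 3) → j ≢ i → y j ≡ x j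

-- C is the union of the pairwise disjoint maximum cliques K 0, …, K (m-1),
-- where K k = (codirection , a tuple in the clique).
CliqueDecomposition : {q : ℕ} → Pred (Word q) → (m : ℕ) → (Fin m → Fin 3 × Word q) → Set
CliqueDecomposition {q} C m K =
  ((k l : Fin m) → k ≢ l → ¬ (∃[ y ] InClique (proj₁ (K k)) (proj₂ (K k)) y
                                   × InClique (proj₁ (K l)) (proj₂ (K l)) y)) ×
  ((y : Word q) → C y ≡ true → ∃[ k ] InClique (proj₁ (K k)) (proj₂ (K k)) y) ×
  ((y : Word q) → (∃[ k ] InClique (proj₁ (K k)) (proj₂ (K k)) y) → C y ≡ true)

CliqueProperty : {q : ℕ} → Pred (Word q) → Set
CliqueProperty C = ∃[ m ] ∃[ K ] CliqueDecomposition C m K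

StrongCliqueProperty : {q : ℕ} → Pred (Word q) → Set
StrongCliqueProperty C =
  ∃[ m ] ∃[ K ] CliqueDecomposition C m K × ((i : Fin 3) → ∃[ k ] proj₁ (K k) ≡ i)

ConstructionD : {q : ℕ} → Pred (Word q) → Set
ConstructionD {q} C =
  Σ (Pred (Fin q)) λ R → Σ (Pred (Fin q)) λ S → Σ (Pred (Fin q)) λ T →
  NonemptyProper R × NonemptyProper S × NonemptyProper T ×
  Σ ℕ λ a → Σ ℕ λ b → Σ ℕ λ c → (a ≥ 1) × (b ≥ 1) × (c ≥ 1) ×
  Σ (Fin q → Fin q → Bool) λ D¹ → Σ (Fin q → Fin q → Bool) λ D² →
  Σ (Fin q → Fin q → Bool) λ D³ →
    ((u v : Fin q) → D¹ u v ≡ true → (S u ≡ true) × (T v ≡ true)) ×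
    ((u v : Fin q) → D² u v ≡ true → (R u ≡ true) × (T v ≡ false)) ×
    ((u v : Fin q) → D³ u v ≡ true → (R u ≡ false) × (S v ≡ false)) ×
    ((v : Fin q) → T v ≡ true  → count (λ u → S u ∧ D¹ u v) ≡ a) ×
    ((u : Fin q) → S u ≡ true  → count (λ v → T v ∧ D¹ u v) ≡ b) ×
    ((v : Fin q) → T v ≡ false → count (λ u → R u ∧ D² u v) ≡ a) ×
    ((u : Fin q) → R u ≡ true  → count (λ v → not (T v) ∧ D² u v) ≡ c) ×
    ((v : Fin q) → S v ≡ false → count (λ u → not (R u) ∧ D³ u v) ≡ b) ×
    ((u : Fin q) → R u ≡ false → count (λ v → not (S v) ∧ D³ u v) ≡ c) ×
    ((x : Word q) → C x ≡ (D¹ (x p₂) (x p₃) ∨ D² (x p₁) (x p₃) ∨ D³ (x p₁) (x p₂)))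

module Submission where

-- A line of H(3,q) is a maximum clique.  Lines of the same direction are equal or disjoint, so a
-- decomposition of C into disjoint maximum cliques amounts to sets D₁, D₂, D₃ of lines, one per
-- direction, such that C is their union and no point lies on lines of two directions.  For the
-- projections S, T of D₁ and R of D₂ this disjointness says exactly D₁ ⊆ S × T, D₂ ⊆ R × T̄,
-- D₃ ⊆ R̄ × S̄.  It remains to see that regularity of C forces the counting conditions.  Let x ∈ C
-- lie on a line of D₁.  Along that line x has no neighbours outside C; the line through x in
-- direction 2 meets C exactly where it crosses lines of D₁ and D₃, i.e. in col D₁ x₃ + row D₃ x₁
-- points, and the one in direction 3 in row D₁ x₂ + row D₂ x₁ points.  Hence
-- β + col D₁ x₃ + row D₁ x₂ + (row D₂ x₁ + row D₃ x₁) = 2q, and moving x along its line shows that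
-- c = row D₂ u + row D₃ u does not depend on u.  In the same way b = col D₃ v + row D₁ v and
-- a = col D₂ v + col D₁ v are constant, and on each of R, S, T and their complements one of the
-- two summands vanishes.  Conversely the lines of Construction D form such a decomposition.

open import Defs
open import Data.Nat using (ℕ; zero; suc; _+_; _≥_; s≤s; z≤n)
open import Data.Nat.Properties using (+-suc; +-assoc; +-comm; +-identityʳ; +-cancelˡ-≡; m≤n+m; m≤m+n; ≤-trans)
open import Data.Nat.Tactic.RingSolver using (solve-∀)
open import Data.Bool using (Bool; true; false; not; _∧_; _∨_; if_then_else_) renaming (_≟_ to _≟ᵇ_)
open import Data.Bool.Properties using (∧-zeroʳ; ∧-conicalʳ; ∨-zeroʳ; ∨-identityʳ; not-¬; ¬-not; ⇔→≡)
open import Function.Base using (_∘_)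
open import Function.Bundles using (mk⇔)
open import Data.List using (List; lookup; length; filter; cartesianProduct; allFin)
open import Data.List.Relation.Unary.All as All using ()
open import Data.List.Relation.Unary.AllPairs using (_∷_)
open import Data.List.Relation.Unary.Any using (index)
open import Data.List.Relation.Unary.Any.Properties using (lookup-index)
open import Data.List.Relation.Unary.Unique.Propositional using (Unique)
open import Data.List.Relation.Unary.Unique.Propositional.Properties using (filter⁺; cartesianProduct⁺; allFin⁺)
open import Data.List.Membership.Propositional using (_∈_)
open import Data.List.Membership.Propositional.Properties
  using (∈-lookup; ∈-filter⁺; ∈-filter⁻; ∈-cartesianProduct⁺; ∈-allFin)
open import Data.Fin using (Fin; zero; suc; _≟_)
open import Data.Fin.Properties using (any?)
open import Data.Product using (Σ; ∃; ∃₂; _×_; _,_; proj₁; proj₂; uncurry)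
open import Data.Product.Properties using (,-injective; ≡-dec)
open import Data.Empty using (⊥-elim)
open import Relation.Nullary using (Dec; yes; no; does; ¬_; contradiction; _×-dec_)
open import Relation.Nullary.Decidable using (dec-true; dec-false)
open import Relation.Binary.PropositionalEquality

does-true⇒ : ∀ {a} {A : Set a} (a? : Dec A) → does a? ≡ true → A
does-true⇒ (yes a) _ = a

private
  variable
    n q : ℕ

count-cong : {f g : Fin n → Bool} → (∀ i → f i ≡ g i) → count f ≡ count g
count-cong {zero}  f≡g = refl
count-cong {suc n} f≡g =
  cong₂ (λ b m → (if b then 1 else 0) + m) (f≡g zero) (count-cong (λ i → f≡g (suc i)))

count≡0 : {f : Fin n → Bool} → (∀ i → f i ≢ true) → count f ≡ 0
count≡0 {zero}          _ = refl
count≡0 {suc n} {f} f≢true with f zero in eq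
... | true  = contradiction eq (f≢true zero)
... | false = count≡0 (λ i → f≢true (suc i))

count≡n : {f : Fin n → Bool} → (∀ i → f i ≡ true) → count f ≡ n
count≡n {zero}          _ = refl
count≡n {suc n} {f} f≡true rewrite f≡true zero = cong suc (count≡n (λ i → f≡true (suc i)))

witness⇒count≥1 : {f : Fin n → Bool} (i : Fin n) → f i ≡ true → count f ≥ 1
witness⇒count≥1 {suc n} {f} zero    fi rewrite fi = s≤s z≤n
witness⇒count≥1 {suc n} {f} (suc i) fi =
  ≤-trans (witness⇒count≥1 {f = λ j → f (suc j)} i fi) (m≤n+m _ (if f zero then 1 else 0))

count≥1⇒witness : {f : Fin n → Bool} → count f ≥ 1 → ∃ λ i → f i ≡ true
count≥1⇒witness {suc n} {f} c≥1 with f zero in eq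
... | true  = zero , eq
... | false with count≥1⇒witness c≥1
...   | i , fi = suc i , fi

count-not+count : (f : Fin n → Bool) → count (λ i → not (f i)) + count f ≡ n
count-not+count {zero}  f = refl
count-not+count {suc n} f with f zero
... | true  = trans (+-suc _ _) (cong suc (count-not+count (λ i → f (suc i))))
... | false = cong suc (count-not+count (λ i → f (suc i)))

count-∨ : {f g : Fin n → Bool} → (∀ i → f i ≡ true → g i ≢ true) →
          count (λ i → f i ∨ g i) ≡ count f + count g
count-∨ {zero} _ = refl
count-∨ {suc n} {f} {g} disjoint with f zero in eqf | g zero in eqg
... | true  | true  = contradiction eqg (disjoint zero eqf)
... | true  | false = cong suc (count-∨ (λ i → disjoint (suc i)))
... | false | true  = trans (cong suc (count-∨ (λ i → disjoint (suc i)))) (sym (+-suc _ _))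
... | false | false = count-∨ (λ i → disjoint (suc i))

count-∧-implied : {f g : Fin n → Bool} → (∀ i → g i ≡ true → f i ≡ true) →
                  count (λ i → f i ∧ g i) ≡ count g
count-∧-implied {f = f} {g} g⇒f = count-cong pointwise
  where
  pointwise : ∀ i → f i ∧ g i ≡ g i
  pointwise i with g i in eq
  ... | true  rewrite g⇒f i eq = refl
  ... | false = ∧-zeroʳ (f i)

count-except-not+count : (f : Fin n → Bool) (x : Fin n) → f x ≡ true →
  count (λ a → not (does (a ≟ x)) ∧ not (f a)) + count f ≡ n
count-except-not+count f x fx =
  trans (cong (_+ count f) (count-cong skip)) (count-not+count f)
  where
  skip : ∀ a → not (does (a ≟ x)) ∧ not (f a) ≡ not (f a)
  skip a with a ≟ x
  ... | yes refl = cong not (sym fx)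
  ... | no  _    = refl

anyTrue : (Fin n → Bool) → Bool
anyTrue f = does (any? (λ i → f i ≟ᵇ true))

anyTrue-intro : (f : Fin n → Bool) (i : Fin n) → f i ≡ true → anyTrue f ≡ true
anyTrue-intro f i fi = dec-true (any? _) (i , fi)

anyTrue-elim : (f : Fin n → Bool) → anyTrue f ≡ true → ∃ λ i → f i ≡ true
anyTrue-elim f = does-true⇒ (any? _)

anyTrue-false : (f : Fin n → Bool) → (∀ i → f i ≢ true) → anyTrue f ≡ false
anyTrue-false f f≢true = dec-false (any? _) (λ (i , fi) → f≢true i fi)

anyTrue-false⇒count≡0 : (f : Fin n → Bool) → anyTrue f ≡ false → count f ≡ 0
anyTrue-false⇒count≡0 f none = count≡0 (λ i fi → not-¬ (anyTrue-intro f i fi) none)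

lookup-injective : ∀ {a} {A : Set a} {xs : List A} → Unique xs →
                   ∀ i j → lookup xs i ≡ lookup xs j → i ≡ j
lookup-injective (_ ∷ _)        zero    zero    _   = refl
lookup-injective (x∉xs ∷ _)     zero    (suc j) x≡y = contradiction x≡y (All.lookup x∉xs (∈-lookup j))
lookup-injective (x∉xs ∷ _)     (suc i) zero    y≡x = contradiction (sym y≡x) (All.lookup x∉xs (∈-lookup i))
lookup-injective (_ ∷ unique)   (suc i) (suc j) e   = cong suc (lookup-injective unique i j e)

other₁ other₂ : Fin 3 → Fin 3
other₁ zero             = p₂
other₁ (suc zero)       = p₁
other₁ (suc (suc zero)) = p₁
other₂ zero             = p₃
other₂ (suc zero)       = p₃
other₂ (suc (suc zero)) = p₂

lineCoords : Fin 3 → Word q → Fin q × Fin q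
lineCoords i y = y (other₁ i) , y (other₂ i)

inClique⇒lineCoords≡ : (i : Fin 3) {w y : Word q} → InClique i w y → lineCoords i y ≡ lineCoords i w
inClique⇒lineCoords≡ zero             w∼y = cong₂ _,_ (w∼y p₂ λ ()) (w∼y p₃ λ ())
inClique⇒lineCoords≡ (suc zero)       w∼y = cong₂ _,_ (w∼y p₁ λ ()) (w∼y p₃ λ ())
inClique⇒lineCoords≡ (suc (suc zero)) w∼y = cong₂ _,_ (w∼y p₁ λ ()) (w∼y p₂ λ ())

lineCoords≡⇒inClique : (i : Fin 3) {w y : Word q} → lineCoords i y ≡ lineCoords i w → InClique i w y
lineCoords≡⇒inClique i {w} {y} y≡w j j≢i = agree i j j≢i (,-injective y≡w)
  where
  agree : ∀ i j → j ≢ i → y (other₁ i) ≡ w (other₁ i) × y (other₂ i) ≡ w (other₂ i) → y j ≡ w j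
  agree zero             zero             j≢i _         = contradiction refl j≢i
  agree zero             (suc zero)       _   (e₁ , _)  = e₁
  agree zero             (suc (suc zero)) _   (_  , e₂) = e₂
  agree (suc zero)       zero             _   (e₁ , _)  = e₁
  agree (suc zero)       (suc zero)       j≢i _         = contradiction refl j≢i
  agree (suc zero)       (suc (suc zero)) _   (_  , e₂) = e₂
  agree (suc (suc zero)) zero             _   (e₁ , _)  = e₁
  agree (suc (suc zero)) (suc zero)       _   (_  , e₂) = e₂
  agree (suc (suc zero)) (suc (suc zero)) j≢i _         = contradiction refl j≢i

word : Fin q → Fin q → Fin q → Word q
word a b c zero             = a
word a b c (suc zero)       = b
word a b c (suc (suc zero)) = c

linePoint : Fin 3 → Fin q × Fin q → Word q
linePoint zero             (u , v) = word u u v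
linePoint (suc zero)       (u , v) = word u u v
linePoint (suc (suc zero)) (u , v) = word u v u

lineCoords-linePoint : (i : Fin 3) (c : Fin q × Fin q) → lineCoords i (linePoint i c) ≡ c
lineCoords-linePoint zero             c = refl
lineCoords-linePoint (suc zero)       c = refl
lineCoords-linePoint (suc (suc zero)) c = refl

LineSet : ℕ → Set
LineSet q = Fin 3 → Fin q → Fin q → Bool

hasLine : LineSet q → Fin 3 → Word q → Bool
hasLine D i y = uncurry (D i) (lineCoords i y)

inUnion : LineSet q → Pred (Word q)
inUnion D y = hasLine D p₁ y ∨ hasLine D p₂ y ∨ hasLine D p₃ y

inUnion-intro : (D : LineSet q) (i : Fin 3) (y : Word q) → hasLine D i y ≡ true → inUnion D y ≡ true
inUnion-intro D zero             y d rewrite d = refl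
inUnion-intro D (suc zero)       y d rewrite d = ∨-zeroʳ _
inUnion-intro D (suc (suc zero)) y d rewrite d | ∨-zeroʳ (hasLine D p₂ y) = ∨-zeroʳ _

inUnion-elim : (D : LineSet q) (y : Word q) → inUnion D y ≡ true → ∃ λ i → hasLine D i y ≡ true
inUnion-elim D y d with hasLine D p₁ y in d₁ | hasLine D p₂ y in d₂ | hasLine D p₃ y in d₃
... | true  | _     | _    = p₁ , d₁
... | false | true  | _    = p₂ , d₂
... | false | false | true = p₃ , d₃

-- lines i u v: the line of direction i whose coordinates at other₁ i and other₂ i are u and v
-- is one of the cliques.
record LinePartition (C : Pred (Word q)) : Set where
  field
    lines         : LineSet q
    cover         : ∀ x → C x ≡ inUnion lines x
    sameDirection : ∀ {i j} y → hasLine lines i y ≡ true → hasLine lines j y ≡ true → i ≡ j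
    inhabited     : ∀ i → ∃₂ λ u v → lines i u v ≡ true

module _ {C : Pred (Word q)} {m : ℕ} {K : Fin m → Fin 3 × Word q}
         (decomposition : CliqueDecomposition C m K) where

  private
    direction : Fin m → Fin 3
    direction k = proj₁ (K k)

    base : Fin m → Word q
    base k = proj₂ (K k)

  cliqueLine? : ∀ i (u v : Fin q) → Dec (∃ λ k → direction k ≡ i × lineCoords i (base k) ≡ (u , v))
  cliqueLine? i u v = any? λ k → (direction k ≟ i) ×-dec ≡-dec _≟_ _≟_ (lineCoords i (base k)) (u , v)

  cliqueLines : LineSet q
  cliqueLines i u v = does (cliqueLine? i u v)

  hasLine-cliqueLines : ∀ k {y} → InClique (direction k) (base k) y →
                        hasLine cliqueLines (direction k) y ≡ true
  hasLine-cliqueLines k y∈k = dec-true (cliqueLine? _ _ _) (k , refl , sym (inClique⇒lineCoords≡ _ y∈k))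

  hasLine-cliqueLines⁻ : ∀ {i y} → hasLine cliqueLines i y ≡ true →
                         ∃ λ k → direction k ≡ i × InClique i (base k) y
  hasLine-cliqueLines⁻ {i} d with does-true⇒ (cliqueLine? _ _ _) d
  ... | k , dir≡i , coords≡ = k , dir≡i , lineCoords≡⇒inClique i (sym coords≡)

  cliques⇒linePartition : (∀ i → ∃ λ k → direction k ≡ i) → LinePartition C
  cliques⇒linePartition directions = record
    { lines         = cliqueLines
    ; cover         = λ x → ⇔→≡ (mk⇔ (covered x) (covering x))
    ; sameDirection = sameDirection
    ; inhabited     = inhabited
    }
    where
    open Σ decomposition renaming (proj₁ to disjoint; proj₂ to covers)

    covered : ∀ x → C x ≡ true → inUnion cliqueLines x ≡ true
    covered x x∈C with (k , x∈k) ← proj₁ covers x x∈C =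
      inUnion-intro cliqueLines (direction k) x (hasLine-cliqueLines k x∈k)

    covering : ∀ x → inUnion cliqueLines x ≡ true → C x ≡ true
    covering x x∈U with (_ , d) ← inUnion-elim cliqueLines x x∈U
                  with (k , refl , x∈k) ← hasLine-cliqueLines⁻ d = proj₂ covers x (k , x∈k)

    sameDirection : ∀ {i j} y → hasLine cliqueLines i y ≡ true → hasLine cliqueLines j y ≡ true → i ≡ j
    sameDirection y dᵢ dⱼ
      with (k , refl , y∈k) ← hasLine-cliqueLines⁻ dᵢ | (l , refl , y∈l) ← hasLine-cliqueLines⁻ dⱼ
      with k ≟ l
    ... | yes refl = refl
    ... | no  k≢l  = contradiction (y , y∈k , y∈l) (disjoint k l k≢l)

    inhabited : ∀ i → ∃₂ λ u v → cliqueLines i u v ≡ true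
    inhabited i with (k , refl) ← directions i =
      base k (other₁ i) , base k (other₂ i) , hasLine-cliqueLines k (λ _ _ → refl)

module _ {C : Pred (Word q)} (partition : LinePartition C) where
  open LinePartition partition

  private
    Line : Set
    Line = Fin 3 × Fin q × Fin q

    Through : Line → Word q → Set
    Through (i , c) y = lineCoords i y ≡ c

    inLines : Line → Bool
    inLines (i , c) = uncurry (lines i) c

    lineClique : Line → Fin 3 × Word q
    lineClique (i , c) = i , linePoint i c

    allLines : List Line
    allLines = cartesianProduct (allFin 3) (cartesianProduct (allFin q) (allFin q))

    partitionLines : List Line
    partitionLines = filter (λ t → inLines t ≟ᵇ true) allLines

    partitionLines-unique : Unique partitionLines
    partitionLines-unique = filter⁺ _ (cartesianProduct⁺ (allFin⁺ 3) (cartesianProduct⁺ (allFin⁺ q) (allFin⁺ q)))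

    ∈-partitionLines : ∀ t → inLines t ≡ true → t ∈ partitionLines
    ∈-partitionLines (i , u , v) =
      ∈-filter⁺ _ (∈-cartesianProduct⁺ (∈-allFin i) (∈-cartesianProduct⁺ (∈-allFin u) (∈-allFin v)))

    m : ℕ
    m = length partitionLines

    K : Fin m → Fin 3 × Word q
    K k = lineClique (lookup partitionLines k)

    inClique-lineClique⁻ : ∀ t {y} → uncurry InClique (lineClique t) y → Through t y
    inClique-lineClique⁻ (i , c) y∈t = trans (inClique⇒lineCoords≡ i y∈t) (lineCoords-linePoint i c)

    inClique-lineClique : ∀ t {y} → Through t y → uncurry InClique (lineClique t) y
    inClique-lineClique (i , c) y∈t = lineCoords≡⇒inClique i (trans y∈t (sym (lineCoords-linePoint i c)))

    through⇒hasLine : ∀ t y → inLines t ≡ true → Through t y → hasLine lines (proj₁ t) y ≡ true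
    through⇒hasLine _ y t∈D refl = t∈D

    throughBoth⇒≡ : ∀ t t' y → inLines t ≡ true → inLines t' ≡ true → Through t y → Through t' y → t ≡ t'
    throughBoth⇒≡ _ _ y t∈D t'∈D refl refl with sameDirection y t∈D t'∈D
    ... | refl = refl

    lookup-inLines : ∀ k → inLines (lookup partitionLines k) ≡ true
    lookup-inLines k = proj₂ (∈-filter⁻ _ {xs = allLines} (∈-lookup k))

  linePartition⇒strongCliques : StrongCliqueProperty C
  linePartition⇒strongCliques = m , K , (disjoint , covered , covering) , directions
    where
    disjoint : ∀ k l → k ≢ l → ¬ (∃ λ y → uncurry InClique (K k) y × uncurry InClique (K l) y)
    disjoint k l k≢l (y , y∈k , y∈l) = k≢l (lookup-injective partitionLines-unique k l
      (throughBoth⇒≡ _ _ y (lookup-inLines k) (lookup-inLines l)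
        (inClique-lineClique⁻ _ y∈k) (inClique-lineClique⁻ _ y∈l)))

    covered : ∀ y → C y ≡ true → ∃ λ k → uncurry InClique (K k) y
    covered y y∈C with (i , d) ← inUnion-elim lines y (trans (sym (cover y)) y∈C) =
      let t∈ = ∈-partitionLines (i , lineCoords i y) d in
      index t∈ , subst (λ t → uncurry InClique (lineClique t) y) (lookup-index t∈)
                       (inClique-lineClique (i , lineCoords i y) refl)

    covering : ∀ y → (∃ λ k → uncurry InClique (K k) y) → C y ≡ true
    covering y (k , y∈k) = trans (cover y) (inUnion-intro lines _ y
      (through⇒hasLine _ y (lookup-inLines k) (inClique-lineClique⁻ _ y∈k)))

    directions : ∀ i → ∃ λ k → proj₁ (K k) ≡ i
    directions i with (u , v , d) ← inhabited i =
      let t∈ = ∈-partitionLines (i , u , v) d in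
      index t∈ , sym (cong proj₁ (lookup-index t∈))

constructionD⇒linePartition : {C : Pred (Word q)} → ConstructionD C → LinePartition C
constructionD⇒linePartition
  (_ , _ , _ , _ , npS , npT , _ , _ , _ , a≥1 , b≥1 , _ , D¹ , D² , D³ ,
   D¹⊆ , D²⊆ , D³⊆ , regT , _ , regT̄ , _ , regS̄ , _ , C≡D) = record
  { lines         = lines
  ; cover         = C≡D
  ; sameDirection = sameDirection
  ; inhabited     = inhabited
  }
  where
  lines : LineSet _
  lines zero             = D¹
  lines (suc zero)       = D²
  lines (suc (suc zero)) = D³

  sameDirection : ∀ {i j} y → hasLine lines i y ≡ true → hasLine lines j y ≡ true → i ≡ j
  sameDirection {zero}           {zero}           _ d d' = refl
  sameDirection {zero}           {suc zero}       _ d d' = ⊥-elim (not-¬ (proj₂ (D¹⊆ _ _ d)) (proj₂ (D²⊆ _ _ d')))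
  sameDirection {zero}           {suc (suc zero)} _ d d' = ⊥-elim (not-¬ (proj₁ (D¹⊆ _ _ d)) (proj₂ (D³⊆ _ _ d')))
  sameDirection {suc zero}       {zero}           _ d d' = ⊥-elim (not-¬ (proj₂ (D¹⊆ _ _ d')) (proj₂ (D²⊆ _ _ d)))
  sameDirection {suc zero}       {suc zero}       _ d d' = refl
  sameDirection {suc zero}       {suc (suc zero)} _ d d' = ⊥-elim (not-¬ (proj₁ (D²⊆ _ _ d)) (proj₁ (D³⊆ _ _ d')))
  sameDirection {suc (suc zero)} {zero}           _ d d' = ⊥-elim (not-¬ (proj₁ (D¹⊆ _ _ d')) (proj₂ (D³⊆ _ _ d)))
  sameDirection {suc (suc zero)} {suc zero}       _ d d' = ⊥-elim (not-¬ (proj₁ (D²⊆ _ _ d')) (proj₁ (D³⊆ _ _ d)))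
  sameDirection {suc (suc zero)} {suc (suc zero)} _ d d' = refl

  witness : ∀ {f g : Fin _ → Bool} {k} → count (λ i → f i ∧ g i) ≡ k → k ≥ 1 → ∃ λ i → g i ≡ true
  witness {f = f} {g} refl k≥1 with (i , fg) ← count≥1⇒witness k≥1 = i , ∧-conicalʳ (f i) (g i) fg

  inhabited : ∀ i → ∃₂ λ u v → lines i u v ≡ true
  inhabited zero
    with (v , v∈T) ← proj₁ npT with (u , d) ← witness (regT v v∈T) a≥1 = u , v , d
  inhabited (suc zero)
    with (v , v∉T) ← proj₂ npT with (u , d) ← witness (regT̄ v v∉T) a≥1 = u , v , d
  inhabited (suc (suc zero))
    with (v , v∉S) ← proj₂ npS with (u , d) ← witness (regS̄ v v∉S) b≥1 = u , v , d

module _ {C : Pred (Word q)} (partition : LinePartition C) (β : ℕ)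
         (β-regular : ∀ x → C x ≡ true → nbrCount (complement C) x ≡ β) where
  open LinePartition partition

  private
    D₁ D₂ D₃ : Fin q → Fin q → Bool
    D₁ = lines p₁
    D₂ = lines p₂
    D₃ = lines p₃

  row col : (Fin q → Fin q → Bool) → Fin q → ℕ
  row D u = count (D u)
  col D v = count (λ u → D u v)

  disjoint₁₂ : ∀ {u v u'} → D₁ u v ≡ true → D₂ u' v ≢ true
  disjoint₁₂ {u} {v} {u'} d d' with () ← sameDirection (word u' u v) d d'

  disjoint₁₃ : ∀ {u v w} → D₁ u v ≡ true → D₃ w u ≢ true
  disjoint₁₃ {u} {v} {w} d d' with () ← sameDirection (word w u v) d d'

  disjoint₂₃ : ∀ {u v w} → D₂ u v ≡ true → D₃ u w ≢ true
  disjoint₂₃ {u} {v} {w} d d' with () ← sameDirection (word u w v) d d'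

  -- nbrCount (complement C) x is by definition outside x p₁ + outside x p₂ + outside x p₃.
  outside : Word q → Fin 3 → ℕ
  outside x j = count (λ a → not (does (a ≟ x j)) ∧ not (C (setAt x j a)))

  lineCount : Word q → Fin 3 → ℕ
  lineCount x j = count (λ a → inUnion lines (setAt x j a))

  outside+lineCount : ∀ x → C x ≡ true → ∀ j → outside x j + lineCount x j ≡ q
  outside+lineCount x x∈C j =
    trans (cong (_+ lineCount x j) (count-cong λ a → cong (λ b → not (does (a ≟ x j)) ∧ not b)
                                                          (cover (setAt x j a))))
          (count-except-not+count _ (x j) (trans (setAt-self j) (trans (sym (cover x)) x∈C)))
    where
    setAt-self : ∀ j → inUnion lines (setAt x j (x j)) ≡ inUnion lines x
    setAt-self zero             = refl
    setAt-self (suc zero)       = refl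
    setAt-self (suc (suc zero)) = refl

  lineSum : Word q → ℕ
  lineSum x = lineCount x p₁ + lineCount x p₂ + lineCount x p₃

  regular-lineSum : ∀ x → C x ≡ true → β + lineSum x ≡ q + q + q
  regular-lineSum x x∈C = begin
    β + lineSum x                                   ≡⟨ cong (_+ lineSum x) (sym (β-regular x x∈C)) ⟩
    (o p₁ + o p₂ + o p₃) + (l p₁ + l p₂ + l p₃)     ≡⟨ interchange₃ (o p₁) (o p₂) (o p₃) (l p₁) (l p₂) (l p₃) ⟩
    (o p₁ + l p₁) + (o p₂ + l p₂) + (o p₃ + l p₃)   ≡⟨ cong₂ _+_ (cong₂ _+_ (along p₁) (along p₂)) (along p₃) ⟩
    q + q + q                                       ∎
    where
    open ≡-Reasoning
    o l : Fin 3 → ℕ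
    o = outside x
    l = lineCount x
    along : ∀ j → o j + l j ≡ q
    along = outside+lineCount x x∈C
    interchange₃ : ∀ a b c d e f → (a + b + c) + (d + e + f) ≡ (a + d) + (b + e) + (c + f)
    interchange₃ = solve-∀

  lineSum-split : ∀ i x → lineSum x ≡ lineCount x i + (lineCount x (other₁ i) + lineCount x (other₂ i))
  lineSum-split zero             x = +-assoc (lineCount x p₁) (lineCount x p₂) (lineCount x p₃)
  lineSum-split (suc zero)       x = pull₂ (lineCount x p₁) (lineCount x p₂) (lineCount x p₃)
    where
    pull₂ : ∀ a b c → a + b + c ≡ b + (a + c)
    pull₂ = solve-∀
  lineSum-split (suc (suc zero)) x = +-comm (lineCount x p₁ + lineCount x p₂) (lineCount x p₃)

  lineCount-full : ∀ i x → hasLine lines i x ≡ true → lineCount x i ≡ q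
  lineCount-full zero             x d = count≡n (λ a → inUnion-intro lines p₁ (setAt x p₁ a) d)
  lineCount-full (suc zero)       x d = count≡n (λ a → inUnion-intro lines p₂ (setAt x p₂ a) d)
  lineCount-full (suc (suc zero)) x d = count≡n (λ a → inUnion-intro lines p₃ (setAt x p₃ a) d)

  regular-on-line : ∀ i x → hasLine lines i x ≡ true →
                    β + (lineCount x (other₁ i) + lineCount x (other₂ i)) ≡ q + q
  regular-on-line i x d = +-cancelˡ-≡ q _ _ (begin
    q + (β + others)                ≡⟨ x+[y+z]≡y+[x+z] q β others ⟩
    β + (q + others)                ≡⟨ cong (λ l → β + (l + others)) (sym (lineCount-full i x d)) ⟩
    β + (lineCount x i + others)    ≡⟨ cong (β +_) (sym (lineSum-split i x)) ⟩
    β + lineSum x                   ≡⟨ regular-lineSum x (trans (cover x) (inUnion-intro lines i x d)) ⟩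
    q + q + q                       ≡⟨ +-assoc q q q ⟩
    q + (q + q)                     ∎)
    where
    open ≡-Reasoning
    others : ℕ
    others = lineCount x (other₁ i) + lineCount x (other₂ i)
    x+[y+z]≡y+[x+z] : ∀ a b c → a + (b + c) ≡ b + (a + c)
    x+[y+z]≡y+[x+z] = solve-∀

  lineCount₁ : ∀ x → D₁ (x p₂) (x p₃) ≡ false → lineCount x p₁ ≡ col D₂ (x p₃) + col D₃ (x p₂)
  lineCount₁ x off =
    trans (count-cong {g = λ a → D₂ a (x p₃) ∨ D₃ a (x p₂)} λ a → cong (_∨ (D₂ a (x p₃) ∨ D₃ a (x p₂))) off)
          (count-∨ {f = λ a → D₂ a (x p₃)} λ a → disjoint₂₃)

  lineCount₂ : ∀ x → D₂ (x p₁) (x p₃) ≡ false → lineCount x p₂ ≡ col D₁ (x p₃) + row D₃ (x p₁)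
  lineCount₂ x off =
    trans (count-cong {g = λ a → D₁ a (x p₃) ∨ D₃ (x p₁) a} λ a → cong (λ b → D₁ a (x p₃) ∨ b ∨ D₃ (x p₁) a) off)
          (count-∨ {f = λ a → D₁ a (x p₃)} λ a → disjoint₁₃)

  lineCount₃ : ∀ x → D₃ (x p₁) (x p₂) ≡ false → lineCount x p₃ ≡ row D₁ (x p₂) + row D₂ (x p₁)
  lineCount₃ x off = trans (count-cong dropLast) (count-∨ {f = D₁ (x p₂)} λ a → disjoint₁₂)
    where
    dropLast : ∀ a → D₁ (x p₂) a ∨ D₂ (x p₁) a ∨ D₃ (x p₁) (x p₂) ≡ D₁ (x p₂) a ∨ D₂ (x p₁) a
    dropLast a rewrite off = cong (D₁ (x p₂) a ∨_) (∨-identityʳ (D₂ (x p₁) a))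

  aVal bVal cVal : Fin q → ℕ
  aVal v = col D₂ v + col D₁ v
  bVal v = col D₃ v + row D₁ v
  cVal u = row D₂ u + row D₃ u

  regular-on-line₁ : ∀ {b c} → D₁ b c ≡ true → ∀ u → (β + (col D₁ c + row D₁ b)) + cVal u ≡ q + q
  regular-on-line₁ {b} {c} d u = trans (regroup β (col D₁ c) (row D₃ u) (row D₁ b) (row D₂ u))
    (subst₂ (λ l₂ l₃ → β + (l₂ + l₃) ≡ q + q)
      (lineCount₂ x (¬-not (disjoint₁₂ d))) (lineCount₃ x (¬-not (disjoint₁₃ d))) (regular-on-line p₁ x d))
    where
    x : Word q
    x = word u b c
    regroup : ∀ β A B E F → (β + (A + E)) + (F + B) ≡ β + ((A + B) + (E + F))
    regroup = solve-∀

  regular-on-line₂ : ∀ {u w} → D₂ u w ≡ true → ∀ v → (β + (col D₂ w + row D₂ u)) + bVal v ≡ q + q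
  regular-on-line₂ {u} {w} d v = trans (regroup β (col D₂ w) (col D₃ v) (row D₁ v) (row D₂ u))
    (subst₂ (λ l₁ l₃ → β + (l₁ + l₃) ≡ q + q)
      (lineCount₁ x (¬-not λ d₁ → disjoint₁₂ d₁ d)) (lineCount₃ x (¬-not (disjoint₂₃ d))) (regular-on-line p₂ x d))
    where
    x : Word q
    x = word u v w
    regroup : ∀ β A B E F → (β + (A + F)) + (B + E) ≡ β + ((A + B) + (E + F))
    regroup = solve-∀

  regular-on-line₃ : ∀ {r s} → D₃ r s ≡ true → ∀ v → (β + (col D₃ s + row D₃ r)) + aVal v ≡ q + q
  regular-on-line₃ {r} {s} d v = trans (regroup β (col D₂ v) (col D₃ s) (col D₁ v) (row D₃ r))
    (subst₂ (λ l₁ l₂ → β + (l₁ + l₂) ≡ q + q)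
      (lineCount₁ x (¬-not λ d₁ → disjoint₁₃ d₁ d)) (lineCount₂ x (¬-not λ d₂ → disjoint₂₃ d₂ d))
      (regular-on-line p₃ x d))
    where
    x : Word q
    x = word r s v
    regroup : ∀ β A B E F → (β + (B + F)) + (A + E) ≡ β + ((A + B) + (E + F))
    regroup = solve-∀

  constant : ∀ k {N} (f : Fin q → ℕ) → (∀ u → k + f u ≡ N) → ∀ u u' → f u ≡ f u'
  constant k f eq u u' = +-cancelˡ-≡ k _ _ (trans (eq u) (sym (eq u')))

  aVal-constant : ∀ {r s} → D₃ r s ≡ true → ∀ v v' → aVal v ≡ aVal v'
  aVal-constant {r} {s} d = constant (β + (col D₃ s + row D₃ r)) aVal (regular-on-line₃ d)

  bVal-constant : ∀ {u w} → D₂ u w ≡ true → ∀ v v' → bVal v ≡ bVal v'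
  bVal-constant {u} {w} d = constant (β + (col D₂ w + row D₂ u)) bVal (regular-on-line₂ d)

  cVal-constant : ∀ {b c} → D₁ b c ≡ true → ∀ u u' → cVal u ≡ cVal u'
  cVal-constant {b} {c} d = constant (β + (col D₁ c + row D₁ b)) cVal (regular-on-line₁ d)

  R S T : Pred (Fin q)
  R u = anyTrue (D₂ u)
  S u = anyTrue (D₁ u)
  T v = anyTrue (λ u → D₁ u v)

  D₁⊆S×T : ∀ u v → D₁ u v ≡ true → S u ≡ true × T v ≡ true
  D₁⊆S×T u v d = anyTrue-intro (D₁ u) v d , anyTrue-intro (λ u → D₁ u v) u d

  D₂⊆R×T̄ : ∀ u v → D₂ u v ≡ true → R u ≡ true × T v ≡ false
  D₂⊆R×T̄ u v d = anyTrue-intro (D₂ u) v d , anyTrue-false (λ u → D₁ u v) λ u' d₁ → disjoint₁₂ d₁ d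

  D₃⊆R̄×S̄ : ∀ u v → D₃ u v ≡ true → R u ≡ false × S v ≡ false
  D₃⊆R̄×S̄ u v d = anyTrue-false (D₂ u) (λ w d₂ → disjoint₂₃ d₂ d) , anyTrue-false (D₁ v) λ w d₁ → disjoint₁₃ d₁ d

  vanishˡ : ∀ {x y} → x ≡ 0 → x + y ≡ y
  vanishˡ refl = refl

  vanishʳ : ∀ {x y} → y ≡ 0 → x + y ≡ x
  vanishʳ refl = +-identityʳ _

  T⇒col₂≡0 : ∀ v → T v ≡ true → col D₂ v ≡ 0
  T⇒col₂≡0 v v∈T with (_ , d) ← anyTrue-elim (λ u → D₁ u v) v∈T = count≡0 {f = λ u → D₂ u v} (λ u → disjoint₁₂ d)

  T̄⇒col₁≡0 : ∀ v → T v ≡ false → col D₁ v ≡ 0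
  T̄⇒col₁≡0 v = anyTrue-false⇒count≡0 (λ u → D₁ u v)

  S⇒col₃≡0 : ∀ u → S u ≡ true → col D₃ u ≡ 0
  S⇒col₃≡0 u u∈S with (_ , d) ← anyTrue-elim (D₁ u) u∈S = count≡0 {f = λ w → D₃ w u} (λ w → disjoint₁₃ d)

  S̄⇒row₁≡0 : ∀ u → S u ≡ false → row D₁ u ≡ 0
  S̄⇒row₁≡0 u = anyTrue-false⇒count≡0 (D₁ u)

  R⇒row₃≡0 : ∀ u → R u ≡ true → row D₃ u ≡ 0
  R⇒row₃≡0 u u∈R with (_ , d) ← anyTrue-elim (D₂ u) u∈R = count≡0 {f = D₃ u} (λ w → disjoint₂₃ d)

  R̄⇒row₂≡0 : ∀ u → R u ≡ false → row D₂ u ≡ 0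
  R̄⇒row₂≡0 u = anyTrue-false⇒count≡0 (D₂ u)

  regular-T : ∀ v → T v ≡ true → count (λ u → S u ∧ D₁ u v) ≡ aVal v
  regular-T v v∈T = trans (count-∧-implied λ u → proj₁ ∘ D₁⊆S×T u v) (sym (vanishˡ (T⇒col₂≡0 v v∈T)))

  regular-S : ∀ u → S u ≡ true → count (λ v → T v ∧ D₁ u v) ≡ bVal u
  regular-S u u∈S = trans (count-∧-implied λ v → proj₂ ∘ D₁⊆S×T u v) (sym (vanishˡ (S⇒col₃≡0 u u∈S)))

  regular-T̄ : ∀ v → T v ≡ false → count (λ u → R u ∧ D₂ u v) ≡ aVal v
  regular-T̄ v v∉T = trans (count-∧-implied λ u → proj₁ ∘ D₂⊆R×T̄ u v) (sym (vanishʳ (T̄⇒col₁≡0 v v∉T)))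

  regular-R : ∀ u → R u ≡ true → count (λ v → not (T v) ∧ D₂ u v) ≡ cVal u
  regular-R u u∈R =
    trans (count-∧-implied λ v → cong not ∘ proj₂ ∘ D₂⊆R×T̄ u v) (sym (vanishʳ (R⇒row₃≡0 u u∈R)))

  regular-S̄ : ∀ v → S v ≡ false → count (λ u → not (R u) ∧ D₃ u v) ≡ bVal v
  regular-S̄ v v∉S =
    trans (count-∧-implied λ u → cong not ∘ proj₁ ∘ D₃⊆R̄×S̄ u v) (sym (vanishʳ (S̄⇒row₁≡0 v v∉S)))

  regular-R̄ : ∀ u → R u ≡ false → count (λ v → not (S v) ∧ D₃ u v) ≡ cVal u
  regular-R̄ u u∉R =
    trans (count-∧-implied λ v → cong not ∘ proj₂ ∘ D₃⊆R̄×S̄ u v) (sym (vanishˡ (R̄⇒row₂≡0 u u∉R)))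

  linePartition⇒constructionD : ConstructionD C
  linePartition⇒constructionD
    with (b₀ , c₀ , d₁) ← inhabited p₁ | (u₀ , w₀ , d₂) ← inhabited p₂ | (r₀ , s₀ , d₃) ← inhabited p₃ =
    R , S , T ,
    ((u₀ , proj₁ (D₂⊆R×T̄ _ _ d₂)) , (r₀ , proj₁ (D₃⊆R̄×S̄ _ _ d₃))) ,
    ((b₀ , proj₁ (D₁⊆S×T _ _ d₁)) , (s₀ , proj₂ (D₃⊆R̄×S̄ _ _ d₃))) ,
    ((c₀ , proj₂ (D₁⊆S×T _ _ d₁)) , (w₀ , proj₂ (D₂⊆R×T̄ _ _ d₂))) ,
    aVal c₀ , bVal b₀ , cVal u₀ ,
    ≤-trans (witness⇒count≥1 b₀ d₁) (m≤n+m _ _) ,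
    ≤-trans (witness⇒count≥1 c₀ d₁) (m≤n+m _ _) ,
    ≤-trans (witness⇒count≥1 w₀ d₂) (m≤m+n _ _) ,
    D₁ , D₂ , D₃ , D₁⊆S×T , D₂⊆R×T̄ , D₃⊆R̄×S̄ ,
    (λ v v∈T → trans (regular-T v v∈T) (aVal-constant d₃ v c₀)) ,
    (λ u u∈S → trans (regular-S u u∈S) (bVal-constant d₂ u b₀)) ,
    (λ v v∉T → trans (regular-T̄ v v∉T) (aVal-constant d₃ v c₀)) ,
    (λ u u∈R → trans (regular-R u u∈R) (cVal-constant d₁ u u₀)) ,
    (λ v v∉S → trans (regular-S̄ v v∉S) (bVal-constant d₂ v b₀)) ,
    (λ u u∉R → trans (regular-R̄ u u∉R) (cVal-constant d₁ u u₀)) ,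
    cover

theorem4 : (q : ℕ) → q ≥ 2 → (C : Pred (Word q)) → CompletelyRegular1 C →
    (StrongCliqueProperty C → ConstructionD C) × (ConstructionD C → StrongCliqueProperty C)
theorem4 q _ C (_ , β , _ , _ , _ , β-regular , _) =
  (λ (_ , _ , decomposition , directions) →
     linePartition⇒constructionD (cliques⇒linePartition decomposition directions) β β-regular) ,
  (λ constructed → linePartition⇒strongCliques (constructionD⇒linePartition constructed))
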